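{- Let $k$ be a positive integer, $h:[n]\to(0,1)$ any hash function, and let $A_0,A_1,A_2$ be pairwise disjoint streams (no identifier occurs in two of them), with $A_1$ containing at least $k$ distinct identifiers, and let $A^*=A_0\circ A_1\circ A_2$ be their concatenation. Then $$\mathrm{AlphaTCF}(k,A^*,h)\le \mathrm{AlphaTCF}(k,A_1,h).$$
   Context: Identifiers come from $[n]$; a stream is a finite sequence of identifiers; $\circ$ denotes concatenation; $h(A)$ is the sequence of hash values in stream order (hash values are assumed distinct for distinct identifiers). AlphaTCF$(k,A,h)$: set $\alpha=k/(k+1)$; let the prefix be the shortest prefix of $h(A)$ containing exactly $k$ distinct hash values and the suffix the rest; $D$ := set of distinct hash values in the prefix; $i:=0$; for each $x$ in the suffix, in order: if $x<\alpha^i$ and $x\notin D$, then $i:=i+1$ and $D:=D\cup\{x\}$. Return $\theta=\alpha^i$.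
   Formalization: The hash function h takes rational values in $(0,1)$ rather than real ones. -}

module Defs where

open import Data.Nat as ℕ using (ℕ; zero; suc)
open import Data.Integer using (+_)
open import Data.Rational using (ℚ; _/_; _*_; _<_; 0ℚ; 1ℚ)
open import Data.Rational.Properties using (_≟_; _<?_)
open import Data.Fin using (Fin)
import Data.Fin.Properties as FinP
open import Data.List using (List; []; _∷_; length; map; deduplicate; _++_)
open import Data.List.Membership.DecPropositional _≟_ using (_∈?_)
open import Data.List.Membership.Propositional using (_∈_; _∉_)
open import Data.Product using (_×_; _,_)
open import Relation.Nullary using (yes; no)
open import Relation.Binary.PropositionalEquality using (_≡_)
open import Function.Definitions using (Injective)

_^ℚ_ : ℚ → ℕ → ℚ
q ^ℚ zero  = 1ℚ
q ^ℚ suc i = q * (q ^ℚ i)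

alpha : ℕ → ℚ
alpha k = (+ k) / suc k

-- If fewer than k distinct values ever occur,
-- the whole sequence is the prefix and the suffix is empty.
prefixPhase : ℕ → List ℚ → List ℚ → List ℚ × List ℚ
prefixPhase k D xs with length D ℕ.≟ k
... | yes _ = D , xs
prefixPhase k D [] | no _ = D , []
prefixPhase k D (x ∷ xs) | no _ with x ∈? D
... | yes _ = prefixPhase k D xs
... | no _  = prefixPhase k (x ∷ D) xs

suffixPhase : ℚ → ℕ → List ℚ → List ℚ → ℕ
suffixPhase α i D [] = i
suffixPhase α i D (x ∷ xs) with x <? (α ^ℚ i) | x ∈? D
... | yes _ | no _ = suffixPhase α (suc i) (x ∷ D) xs
... | _     | _    = suffixPhase α i D xs

AlphaTCF : {n : ℕ} → ℕ → List (Fin n) → (Fin n → ℚ) → ℚ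
AlphaTCF k A h with prefixPhase k [] (map h A)
... | D , suffix = alpha k ^ℚ suffixPhase (alpha k) 0 D suffix

distinctCount : {n : ℕ} → List (Fin n) → ℕ
distinctCount A = length (deduplicate FinP._≟_ A)

Disjoint : {n : ℕ} → List (Fin n) → List (Fin n) → Set
Disjoint A B = ∀ x → x ∈ A → x ∉ B

{-# OPTIONS --safe #-}
-- AlphaTCF is a function of one growing set D of hash values: a value x joins D
-- iff x ∉ D and either |D| < k or x < α^(|D| ∸ k), and the output is α^(|D| ∸ k)
-- (after the prefix, the counter i is exactly |D| ∸ k).  Run A₁ from ∅ (set E)
-- and from the set left by A₀ (set D); by disjointness D holds no value of A₁.
-- Throughout, |E| ≤ |D| and every value still to come that lies in D lies in E.
-- A larger set has a lower threshold, so E can admit a value that D rejects only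
-- when |E| < |D|, and a value D admits but E rejects is already in E.  So D ends
-- A₁ at least as large as E, A₂ only enlarges it, and α^(· ∸ k) is antitone.
module Submission where

open import Defs
open import Data.Nat using (ℕ; _≥_; NonZero)
open import Data.Rational using (ℚ; _<_; _≤_; 0ℚ; 1ℚ)
open import Data.Fin using (Fin)
open import Data.List using (List; _++_)
open import Data.Product using (_×_)
open import Relation.Binary.PropositionalEquality using (_≡_)
open import Function.Definitions using (Injective)

open import Data.Nat as ℕ using (zero; suc; z≤n; s≤s; _∸_; _+_)
open import Data.Nat.Properties as ℕP
  using (≤∧≢⇒<; m≤n⇒m≤1+n; ∸-monoˡ-≤; m≤n⇒m∸n≡0; m+n∸m≡n; +-suc; +-identityʳ)
open import Data.Integer as ℤ using (+_)
import Data.Integer.Properties as ℤP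
open import Data.Rational using (NonNegative)
open import Data.Rational.Properties as ℚP
  using ( _<?_; ≤-refl; ≤-trans; <-≤-trans; ≤-reflexive; *-identityˡ
        ; *-monoʳ-≤-nonNeg; *-monoˡ-≤-nonNeg)
import Data.Rational.Unnormalised as ℚᵘ
import Data.Rational.Unnormalised.Properties as ℚᵘP
open import Data.List using ([]; _∷_; length; map; foldl)
open import Data.List.Properties using (map-++; foldl-++)
open import Data.List.Membership.Propositional using (_∈_; _∉_)
open import Data.List.Membership.Propositional.Properties using (∈-map⁻)
open import Data.List.Membership.DecPropositional ℚP._≟_ using (_∈?_)
open import Data.List.Relation.Unary.Any using (here; there)
open import Data.Product using (_,_; uncurry)
open import Data.Sum using (_⊎_; inj₁; inj₂)
open import Function using (_∘_)
open import Relation.Nullary using (Dec; yes; no; ¬?; contradiction)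
open import Relation.Nullary.Decidable using (_×-dec_; _⊎-dec_; decidable-stable)
open import Relation.Binary.PropositionalEquality using (_≢_; refl; sym; trans; cong; subst; subst₂)

^ℚ-nonNeg : ∀ q .{{_ : NonNegative q}} i → NonNegative (q ^ℚ i)
^ℚ-nonNeg q zero    = _
^ℚ-nonNeg q (suc i) = ℚP.nonNeg*nonNeg⇒nonNeg q (q ^ℚ i) {{^ℚ-nonNeg q i}}

^ℚ-suc-≤ : ∀ q .{{_ : NonNegative q}} → q ≤ 1ℚ → ∀ i → q ^ℚ suc i ≤ q ^ℚ i
^ℚ-suc-≤ q q≤1 i =
  ≤-trans (*-monoʳ-≤-nonNeg (q ^ℚ i) {{^ℚ-nonNeg q i}} q≤1) (≤-reflexive (*-identityˡ (q ^ℚ i)))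

^ℚ-antitone : ∀ q .{{_ : NonNegative q}} → q ≤ 1ℚ → ∀ {m n} → m ℕ.≤ n → q ^ℚ n ≤ q ^ℚ m
^ℚ-antitone q q≤1 {zero}  {zero}  z≤n       = ≤-refl
^ℚ-antitone q q≤1 {zero}  {suc n} z≤n       =
  ≤-trans (^ℚ-suc-≤ q q≤1 n) (^ℚ-antitone q q≤1 {zero} {n} z≤n)
^ℚ-antitone q q≤1 {suc m} {suc n} (s≤s m≤n) = *-monoˡ-≤-nonNeg q (^ℚ-antitone q q≤1 m≤n)

alpha-nonNeg : ∀ k → NonNegative (alpha k)
alpha-nonNeg k = ℚP.normalize-nonNeg k (suc k)

-- alpha k is by definition fromℚᵘ (mkℚᵘ (+ k) k).
alpha≤1 : ∀ k → alpha k ≤ 1ℚ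
alpha≤1 k = ℚP.toℚᵘ-cancel-≤
  (ℚᵘP.≤-respˡ-≃ (ℚᵘP.≃-sym (ℚP.toℚᵘ-fromℚᵘ (ℚᵘ.mkℚᵘ (+ k) k))) (ℚᵘ.*≤* k≤1+k))
  where
  k≤1+k : + k ℤ.* + 1 ℤ.≤ + 1 ℤ.* + suc k
  k≤1+k = subst₂ ℤ._≤_ (sym (ℤP.*-identityʳ (+ k))) (sym (ℤP.*-identityˡ (+ suc k)))
            (ℤ.+≤+ (ℕP.n≤1+n k))

map-disjoint : ∀ {n} {h : Fin n → ℚ} → Injective _≡_ _≡_ h →
               ∀ {A B} → Disjoint A B → ∀ {y} → y ∈ map h A → y ∉ map h B
map-disjoint {h = h} h-injective A#B y∈hA y∈hB with ∈-map⁻ h y∈hA | ∈-map⁻ h y∈hB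
... | a , a∈A , refl | b , b∈B , ha≡hb = A#B a a∈A (subst (_∈ _) (sym (h-injective ha≡hb)) b∈B)

module Sample (k : ℕ) (α : ℚ) where

  threshold : ℕ → ℚ
  threshold m = α ^ℚ (m ∸ k)

  Accepts : ℕ → ℚ → Set
  Accepts m x = m ℕ.< k ⊎ x < threshold m

  Admissible : List ℚ → ℚ → Set
  Admissible D x = x ∉ D × Accepts (length D) x

  admissible? : ∀ D x → Dec (Admissible D x)
  admissible? D x = ¬? (x ∈? D) ×-dec (length D ℕ.<? k ⊎-dec x <? threshold (length D))

  admit : List ℚ → ℚ → List ℚ
  admit D x with admissible? D x
  ... | yes _ = x ∷ D
  ... | no _  = D

  sample : List ℚ → List ℚ
  sample = foldl admit []

  threshold-k+ : ∀ i → threshold (k + i) ≡ α ^ℚ i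
  threshold-k+ i = cong (α ^ℚ_) (m+n∸m≡n k i)

  Accepts[k+i]⇒<αⁱ : ∀ {m i x} → m ≡ k + i → Accepts m x → x < α ^ℚ i
  Accepts[k+i]⇒<αⁱ {i = i} refl (inj₁ k+i<k) = contradiction k+i<k (ℕP.m+n≮m k i)
  Accepts[k+i]⇒<αⁱ {i = i} refl (inj₂ x<θ)   = subst (_ <_) (threshold-k+ i) x<θ

  <αⁱ⇒Accepts[k+i] : ∀ {m i x} → m ≡ k + i → x < α ^ℚ i → Accepts m x
  <αⁱ⇒Accepts[k+i] {i = i} refl x<αⁱ = inj₂ (subst (_ <_) (sym (threshold-k+ i)) x<αⁱ)

  suffixPhase≡ : ∀ i D xs → length D ≡ k + i →
                 suffixPhase α i D xs ≡ length (foldl admit D xs) ∸ k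
  suffixPhase≡ i D [] |D|≡k+i = sym (trans (cong (_∸ k) |D|≡k+i) (m+n∸m≡n k i))
  suffixPhase≡ i D (x ∷ xs) |D|≡k+i with admissible? D x
  ... | yes (x∉D , acc) with x <? α ^ℚ i | x ∈? D
  ...   | yes _    | no _    =
    suffixPhase≡ (suc i) (x ∷ D) xs (trans (cong suc |D|≡k+i) (sym (+-suc k i)))
  ...   | yes _    | yes x∈D = contradiction x∈D x∉D
  ...   | no x≮αⁱ  | _       = contradiction (Accepts[k+i]⇒<αⁱ |D|≡k+i acc) x≮αⁱ
  suffixPhase≡ i D (x ∷ xs) |D|≡k+i | no ¬adm with x <? α ^ℚ i | x ∈? D
  ...   | yes x<αⁱ | no x∉D  = contradiction (x∉D , <αⁱ⇒Accepts[k+i] |D|≡k+i x<αⁱ) ¬adm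
  ...   | yes _    | yes _   = suffixPhase≡ i D xs |D|≡k+i
  ...   | no _     | _       = suffixPhase≡ i D xs |D|≡k+i

  prefixPhase≡ : ∀ D xs → length D ℕ.≤ k →
                 uncurry (suffixPhase α 0) (prefixPhase k D xs) ≡ length (foldl admit D xs) ∸ k
  prefixPhase≡ D xs |D|≤k with length D ℕ.≟ k
  ... | yes |D|≡k = suffixPhase≡ 0 D xs (trans |D|≡k (sym (+-identityʳ k)))
  prefixPhase≡ D []       |D|≤k | no _ = sym (m≤n⇒m∸n≡0 |D|≤k)
  prefixPhase≡ D (x ∷ xs) |D|≤k | no |D|≢k with admissible? D x
  ... | yes (x∉D , _) with x ∈? D
  ...   | yes x∈D = contradiction x∈D x∉D
  ...   | no _    = prefixPhase≡ (x ∷ D) xs (≤∧≢⇒< |D|≤k |D|≢k)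
  prefixPhase≡ D (x ∷ xs) |D|≤k | no |D|≢k | no ¬adm with x ∈? D
  ...   | yes _   = prefixPhase≡ D xs |D|≤k
  ...   | no x∉D  = contradiction (x∉D , inj₁ (≤∧≢⇒< |D|≤k |D|≢k)) ¬adm

  -- The left-hand side is AlphaTCF k A h for xs = map h A and α = alpha k.
  TCF≡threshold : ∀ xs → α ^ℚ uncurry (suffixPhase α 0) (prefixPhase k [] xs)
                         ≡ threshold (length (sample xs))
  TCF≡threshold xs = cong (α ^ℚ_) (prefixPhase≡ [] xs z≤n)

  ∈-admit⁻ : ∀ {y D x} → y ∈ admit D x → y ≡ x ⊎ y ∈ D
  ∈-admit⁻ {D = D} {x} y∈ with admissible? D x | y∈
  ... | yes _ | here y≡x  = inj₁ y≡x
  ... | yes _ | there y∈D = inj₂ y∈D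
  ... | no _  | y∈D       = inj₂ y∈D

  ∈-foldl-admit⁻ : ∀ {y} D xs → y ∈ foldl admit D xs → y ∈ D ⊎ y ∈ xs
  ∈-foldl-admit⁻ D []       y∈D = inj₁ y∈D
  ∈-foldl-admit⁻ D (x ∷ xs) y∈  with ∈-foldl-admit⁻ (admit D x) xs y∈
  ... | inj₂ y∈xs = inj₂ (there y∈xs)
  ... | inj₁ y∈D′ with ∈-admit⁻ {D = D} {x} y∈D′
  ...   | inj₁ refl = inj₂ (here refl)
  ...   | inj₂ y∈D  = inj₁ y∈D

  length-admit : ∀ D x → length D ℕ.≤ length (admit D x)
  length-admit D x with admissible? D x
  ... | yes _ = ℕP.n≤1+n (length D)
  ... | no _  = ℕP.≤-refl

  length-foldl-admit : ∀ D xs → length D ℕ.≤ length (foldl admit D xs)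
  length-foldl-admit D []       = ℕP.≤-refl
  length-foldl-admit D (x ∷ xs) = ℕP.≤-trans (length-admit D x) (length-foldl-admit (admit D x) xs)

  -- D and E are the sets of two runs; xs is the input both have yet to read.
  Ahead : List ℚ → List ℚ → List ℚ → Set
  Ahead xs D E = length E ℕ.≤ length D × (∀ {y} → y ∈ xs → y ∈ D → y ∈ E)

  module Antitone .{{_ : NonNegative α}} (α≤1 : α ≤ 1ℚ) where

    threshold-antitone : ∀ {m n} → m ℕ.≤ n → threshold n ≤ threshold m
    threshold-antitone m≤n = ^ℚ-antitone α α≤1 (∸-monoˡ-≤ k m≤n)

    Accepts-antitone : ∀ {m n x} → m ℕ.≤ n → Accepts n x → Accepts m x
    Accepts-antitone m≤n (inj₁ n<k)  = inj₁ (ℕP.≤-<-trans m≤n n<k)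
    Accepts-antitone m≤n (inj₂ x<θₙ) = inj₂ (<-≤-trans x<θₙ (threshold-antitone m≤n))

    Ahead-admit : ∀ {x xs D E} → Ahead (x ∷ xs) D E → Ahead xs (admit D x) (admit E x)
    Ahead-admit {x} {xs} {D} {E} (|E|≤|D| , D⊆E) with admissible? D x | admissible? E x
    ... | yes _ | yes _ = s≤s |E|≤|D| , λ where
        _    (here refl)  → here refl
        y∈xs (there y∈D) → there (D⊆E (there y∈xs) y∈D)
    ... | yes (_ , acc) | no ¬adm = m≤n⇒m≤1+n |E|≤|D| , λ where
        _    (here refl)  → decidable-stable (x ∈? E)
                               (λ x∉E → ¬adm (x∉E , Accepts-antitone |E|≤|D| acc))
        y∈xs (there y∈D) → D⊆E (there y∈xs) y∈D
    ... | no ¬adm | yes (x∉E , acc) =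
      ≤∧≢⇒< |E|≤|D| |E|≢|D| , λ y∈xs y∈D → there (D⊆E (there y∈xs) y∈D)
      where
      |E|≢|D| : length E ≢ length D
      |E|≢|D| |E|≡|D| = ¬adm ( (λ x∈D → x∉E (D⊆E (here refl) x∈D))
                             , Accepts-antitone (ℕP.≤-reflexive (sym |E|≡|D|)) acc)
    ... | no _ | no _ = |E|≤|D| , λ y∈xs → D⊆E (there y∈xs)

    Ahead-foldl-admit : ∀ xs {D E} → Ahead xs D E →
                        length (foldl admit E xs) ℕ.≤ length (foldl admit D xs)
    Ahead-foldl-admit []       (|E|≤|D| , _) = |E|≤|D|
    Ahead-foldl-admit (x ∷ xs) ahead         = Ahead-foldl-admit xs (Ahead-admit ahead)

    length-sample-++-disjoint : ∀ as bs cs → (∀ {y} → y ∈ as → y ∉ bs) →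
                                length (sample bs) ℕ.≤ length (sample (as ++ bs ++ cs))
    length-sample-++-disjoint as bs cs as#bs = begin
      length (sample bs)                          ≤⟨ Ahead-foldl-admit bs (z≤n , D₀#bs) ⟩
      length (foldl admit D₀ bs)                  ≤⟨ length-foldl-admit (foldl admit D₀ bs) cs ⟩
      length (foldl admit (foldl admit D₀ bs) cs) ≡⟨ cong length (foldl-++ admit D₀ bs cs) ⟨
      length (foldl admit D₀ (bs ++ cs))          ≡⟨ cong length (foldl-++ admit [] as (bs ++ cs)) ⟨
      length (sample (as ++ bs ++ cs))            ∎
      where
      open ℕP.≤-Reasoning
      D₀ = sample as
      D₀#bs : ∀ {y} → y ∈ bs → y ∈ D₀ → y ∈ []
      D₀#bs y∈bs y∈D₀ with ∈-foldl-admit⁻ [] as y∈D₀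
      ... | inj₂ y∈as = contradiction y∈bs (as#bs y∈as)

theorem15 : (n k : ℕ) → .{{NonZero k}} → (h : Fin n → ℚ) → (∀ x → 0ℚ < h x × h x < 1ℚ) → Injective _≡_ _≡_ h → (A₀ A₁ A₂ : List (Fin n)) → Disjoint A₀ A₁ → Disjoint A₀ A₂ → Disjoint A₁ A₂ → distinctCount A₁ ≥ k → AlphaTCF k (A₀ ++ A₁ ++ A₂) h ≤ AlphaTCF k A₁ h
theorem15 _ k h _ h-injective A₀ A₁ A₂ A₀#A₁ _ _ _ = begin
  AlphaTCF k (A₀ ++ A₁ ++ A₂) h                            ≡⟨ TCF≡threshold (map h (A₀ ++ A₁ ++ A₂)) ⟩
  threshold (length (sample (map h (A₀ ++ A₁ ++ A₂))))     ≡⟨ cong (threshold ∘ length ∘ sample) map-++₃ ⟩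
  threshold (length (sample (map h A₀ ++ map h A₁ ++ map h A₂)))
    ≤⟨ threshold-antitone (length-sample-++-disjoint _ _ _ (map-disjoint h-injective A₀#A₁)) ⟩
  threshold (length (sample (map h A₁)))                   ≡⟨ TCF≡threshold (map h A₁) ⟨
  AlphaTCF k A₁ h                                          ∎
  where
  open Sample k (alpha k)
  open Antitone {{alpha-nonNeg k}} (alpha≤1 k)
  open ℚP.≤-Reasoning
  map-++₃ : map h (A₀ ++ A₁ ++ A₂) ≡ map h A₀ ++ map h A₁ ++ map h A₂
  map-++₃ = trans (map-++ h A₀ (A₁ ++ A₂)) (cong (map h A₀ ++_) (map-++ h A₁ A₂))
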